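{- For every black-white tree $t$ with black root, the trees $t$ and $\mathsf{BwtoBz}(t)$ have the same size (number of nodes).
   Context: A black-white tree is a finite rooted binary tree (each node has an optional left child and an optional right child) whose nodes are coloured black or white, such that black nodes have no right child, a black node's left child may be of either colour, a white node's left child (if any) is white and a white node's right child (if any) is black. Size is the number of nodes. The map $\mathsf{BwtoBz}$ from black-white trees (of either root colour) to uncoloured binary trees is defined recursively by cases on $t$: (1) $t$ a single black node $\mapsto$ a single node; (2) $t$ has black root whose left subtree $t'$ has black root $\mapsto$ a node with no left child and right subtree $\mathsf{BwtoBz}(t')$; (3) $t$ has black root whose left subtree $t'$ has white root $\mapsto \mathsf{BwtoBz}(t')$; (4) $t$ a single white node $\mapsto$ a node whose only child is a left leaf; (5) $t$ has white root with only a left subtree $t'$ $\mapsto$ a node with left subtree $\mathsf{BwtoBz}(t')$ and no right child; (6) $t$ has white root with only a right subtree $t'$ $\mapsto$ a node whose left child is a leaf and whose right subtree is $\mathsf{BwtoBz}(t')$; (7) $t$ has white root with left subtree $t'$ and right subtree $t''$ $\mapsto$ a node with left subtree $\mathsf{BwtoBz}(t')$ and right subtree $\mathsf{BwtoBz}(t'')$. -}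

module Defs where

open import Data.Nat using (ℕ; zero; suc; _+_)
open import Data.Maybe using (Maybe; just; nothing)

-- A black node has no right child; its optional left child is black or white.
data BTree : Set
data WTree : Set

data BTree where
  bleaf : BTree
  bB    : BTree → BTree
  bW    : WTree → BTree

data WTree where
  wnode : Maybe WTree → Maybe BTree → WTree

data BinTree : Set where
  node : Maybe BinTree → Maybe BinTree → BinTree

sizeB : BTree → ℕ
sizeW : WTree → ℕ
sizeMW : Maybe WTree → ℕ
sizeMB : Maybe BTree → ℕ
sizeB bleaf = 1
sizeB (bB t) = suc (sizeB t)
sizeB (bW t) = suc (sizeW t)
sizeW (wnode l r) = suc (sizeMW l + sizeMB r)
sizeMW nothing = 0
sizeMW (just t) = sizeW t
sizeMB nothing = 0
sizeMB (just t) = sizeB t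

size : BinTree → ℕ
sizeM : Maybe BinTree → ℕ
size (node l r) = suc (sizeM l + sizeM r)
sizeM nothing = 0
sizeM (just t) = size t

leaf : BinTree
leaf = node nothing nothing

BwtoBzB : BTree → BinTree
BwtoBzW : WTree → BinTree
BwtoBzB bleaf  = leaf
BwtoBzB (bB t) = node nothing (just (BwtoBzB t))
BwtoBzB (bW t) = BwtoBzW t
BwtoBzW (wnode nothing nothing)   = node (just leaf) nothing
BwtoBzW (wnode (just l) nothing)  = node (just (BwtoBzW l)) nothing
BwtoBzW (wnode nothing (just r))  = node (just leaf) (just (BwtoBzB r))
BwtoBzW (wnode (just l) (just r)) = node (just (BwtoBzW l)) (just (BwtoBzB r))

-- Proved together with its white-rooted companion: BwtoBz maps a white-rooted
-- tree to one with exactly one node more, the extra left leaf created in cases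
-- (4) and (6). A black root over a white left child is dropped in case (3),
-- cancelling that surplus; all other cases keep the node count.
module Submission where

open import Defs
open import Relation.Binary.PropositionalEquality using (_≡_; refl; cong)
open import Data.Maybe using (just; nothing)
open import Data.Nat using (suc)

size-BwtoBzB : (t : BTree) → size (BwtoBzB t) ≡ sizeB t
size-BwtoBzW : (w : WTree) → size (BwtoBzW w) ≡ suc (sizeW w)

size-BwtoBzB bleaf  = refl
size-BwtoBzB (bB t) = cong suc (size-BwtoBzB t)
size-BwtoBzB (bW w) = size-BwtoBzW w

size-BwtoBzW (wnode nothing  nothing)  = refl
size-BwtoBzW (wnode (just l) nothing)  rewrite size-BwtoBzW l = refl
size-BwtoBzW (wnode nothing  (just r)) rewrite size-BwtoBzB r = refl
size-BwtoBzW (wnode (just l) (just r)) rewrite size-BwtoBzW l | size-BwtoBzB r = refl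

mainTheorem4 : (t : BTree) → size (BwtoBzB t) ≡ sizeB t
mainTheorem4 = size-BwtoBzB
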